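{- For all terms $u$, $f$, $t$ and every variable $x$, the star abstraction $\lambda x.u$ is syntactically different from ${\bf tagged}\{f,t\}$.
   Context: Terms are given by the grammar $p ::= S \mid K \mid p\,q \mid y$, where $S$ and $K$ are constants, $y$ ranges over term variables, and application is left-associative; equality of terms is syntactic equality. Let $I = SKK$, and let ${\bf fv}(t)$ denote the set of variables occurring in $t$. Star abstraction $\lambda x.t$ is defined by recursion on $t$: if $t$ is a variable $y$, then $\lambda x.t = I$ if $y = x$ and $\lambda x.t = K\,y$ otherwise; $\lambda x.S = KS$; $\lambda x.K = KK$; and for an application $t = t_1\,t_2$, $\lambda x.t = S(\lambda x.t_1)(\lambda x.t_2)$ if $x \in {\bf fv}(t_1 t_2)$, and $\lambda x.t = K(t_1 t_2)$ otherwise. Define ${\bf tagged}\{f,t\} = S(S(KK)f)\big(S(S(KK)(KK))(Kt)\big)$ for terms $f,t$. -}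

module Defs where

open import Data.Nat using (ℕ; _≡ᵇ_)
open import Data.Bool using (Bool; true; false; _∨_; if_then_else_)

Var : Set
Var = ℕ

infixl 9 _·_

data Term : Set where
  S K : Term
  _·_ : Term → Term → Term
  var : Var → Term

I : Term
I = S · K · K

occurs : Var → Term → Bool
occurs x S = false
occurs x K = false
occurs x (t₁ · t₂) = occurs x t₁ ∨ occurs x t₂
occurs x (var y) = x ≡ᵇ y

abs : Var → Term → Term
abs x (var y) = if x ≡ᵇ y then I else K · var y
abs x S = K · S
abs x K = K · K
abs x (t₁ · t₂) =
  if occurs x (t₁ · t₂) then S · abs x t₁ · abs x t₂ else K · (t₁ · t₂)

tagged : Term → Term → Term
tagged f t = S · (S · (K · K) · f) · (S · (S · (K · K) · (K · K)) · (K · t))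

{-# OPTIONS --safe #-}
module Submission where

-- Star abstraction produces a term of the form K v only when v is the abstracted term itself
-- and x does not occur in it, and a term S a b with a ≠ K only through the compound rule
-- (S K K = I comes from abs x (var x)). Peeling tagged{f,t} twice with the second fact
-- reaches a compound abstraction equal to S (K K) (K K); by the first fact both of its
-- components are x-free, contradicting the side condition of the compound rule.

open import Data.Bool using (true; false; _∨_)
open import Data.Product using (_×_; _,_; proj₂; ∃₂)
open import Data.Nat using (_≡ᵇ_)
open import Relation.Binary.PropositionalEquality using (_≡_; _≢_; refl; trans; sym; cong₂)
open import Relation.Nullary.Negation using (contradiction)

open import Defs

abs-K-inv : ∀ x w {v} → abs x w ≡ K · v → w ≡ v × occurs x w ≡ false
abs-K-inv x (var y) e with x ≡ᵇ y
abs-K-inv x (var y) ()   | true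
abs-K-inv x (var y) refl | false = refl , refl
abs-K-inv x S refl = refl , refl
abs-K-inv x K refl = refl , refl
abs-K-inv x (w₁ · w₂) e with occurs x w₁ ∨ occurs x w₂
abs-K-inv x (w₁ · w₂) ()   | true
abs-K-inv x (w₁ · w₂) refl | false = refl , refl

abs-S-inv : ∀ x w {a b} → a ≢ K → abs x w ≡ S · a · b →
            ∃₂ λ w₁ w₂ → w ≡ w₁ · w₂ × occurs x w ≡ true × abs x w₁ ≡ a × abs x w₂ ≡ b
abs-S-inv x (var y) a≢K e with x ≡ᵇ y
abs-S-inv x (var y) a≢K refl | true = contradiction refl a≢K
abs-S-inv x (var y) a≢K ()   | false
abs-S-inv x S a≢K ()
abs-S-inv x K a≢K ()
abs-S-inv x (w₁ · w₂) a≢K e with occurs x w₁ ∨ occurs x w₂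
abs-S-inv x (w₁ · w₂) a≢K refl | true = w₁ , w₂ , refl , refl , refl , refl
abs-S-inv x (w₁ · w₂) a≢K ()   | false

abs≢S-K-K : ∀ x w {p q} → abs x w ≢ S · (K · p) · (K · q)
abs≢S-K-K x w e with abs-S-inv x w (λ ()) e
... | w₁ , w₂ , refl , x∈w , abs-w₁ , abs-w₂ = false≢true (trans (sym x∉w) x∈w)
  where
  x∉w : occurs x (w₁ · w₂) ≡ false
  x∉w = cong₂ _∨_ (proj₂ (abs-K-inv x w₁ abs-w₁)) (proj₂ (abs-K-inv x w₂ abs-w₂))

  false≢true : false ≢ true
  false≢true ()

mainTheorem2 : (u f t : Term) (x : Var) → abs x u ≢ tagged f t
mainTheorem2 u f t x abs≡tagged with abs-S-inv x u (λ ()) abs≡tagged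
... | _ , w , _ , _ , _ , abs-w with abs-S-inv x w (λ ()) abs-w
... | v , _ , _ , _ , abs-v , _ = abs≢S-K-K x v abs-v
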